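{- Let $\mathcal{T}$ be a test cover of $[n]$, let $k$ be an integer, and let $\mathcal{F}\subseteq\mathcal{T}$ be such that the number of classes induced by $\mathcal{F}$ is at least $|\mathcal{F}|+k$. Then there is a test cover $\mathcal{F}'$ of $[n]$ with $\mathcal{F}\subseteq\mathcal{F}'\subseteq\mathcal{T}$ and $|\mathcal{F}'|\le n-k$. Moreover, if $\mathcal{T}$ contains all singletons $\{i\}$, $i\in[n]$, then $\mathcal{F}'$ can be chosen so that every test in $\mathcal{F}'\setminus\mathcal{F}$ is a singleton.
   Context: $[n]=\{1,\ldots,n\}$ is the set of items; tests are subsets of $[n]$ and $\mathcal{T}$ is a collection of distinct tests. A test $T$ separates distinct items $i,j$ if $|\{i,j\}\cap T|=1$; a collection of tests is a test cover of $[n]$ if every pair of distinct items is separated by one of its tests. The classes induced by a collection $\mathcal{F}$ of tests are the equivalence classes of the relation on $[n]$ "$i$ and $j$ are not separated by any test of $\mathcal{F}$". -}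

module Defs where

open import Data.Nat using (ℕ)
open import Data.Fin using (Fin; _<_; _<?_)
open import Data.Fin.Subset using (Subset; _∈_; _∉_)
open import Data.Fin.Subset.Properties using (_∈?_)
open import Data.List using (List; length; filter; allFin)
open import Data.List.Relation.Unary.Any using (Any; any?)
open import Data.List.Relation.Unary.All using (All; all?)
open import Data.Product using (_×_)
open import Data.Sum using (_⊎_)
open import Relation.Nullary using (Dec; ¬?)
open import Relation.Nullary.Decidable using (_×-dec_; _⊎-dec_)
open import Relation.Binary.PropositionalEquality using (_≢_)

-- Items are the elements of Fin n (standing for [n]); a test is a Subset n;
-- a collection of tests is a List of tests (distinctness imposed separately via Unique).

Separates : {n : ℕ} → Subset n → Fin n → Fin n → Set
Separates T i j = (i ∈ T × j ∉ T) ⊎ (i ∉ T × j ∈ T)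

separates? : {n : ℕ} (T : Subset n) (i j : Fin n) → Dec (Separates T i j)
separates? T i j = ((i ∈? T) ×-dec ¬? (j ∈? T)) ⊎-dec (¬? (i ∈? T) ×-dec (j ∈? T))

SeparatedBy : {n : ℕ} → List (Subset n) → Fin n → Fin n → Set
SeparatedBy F i j = Any (λ T → Separates T i j) F

separatedBy? : {n : ℕ} (F : List (Subset n)) (i j : Fin n) → Dec (SeparatedBy F i j)
separatedBy? F i j = any? (λ T → separates? T i j) F

IsTestCover : {n : ℕ} → List (Subset n) → Set
IsTestCover {n} F = (i j : Fin n) → i ≢ j → SeparatedBy F i j

below : {n : ℕ} → Fin n → List (Fin n)
below {n} i = filter (λ j → j <? i) (allFin n)

IsClassRep : {n : ℕ} → List (Subset n) → Fin n → Set
IsClassRep F i = All (λ j → SeparatedBy F j i) (below i)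

isClassRep? : {n : ℕ} (F : List (Subset n)) (i : Fin n) → Dec (IsClassRep F i)
isClassRep? F i = all? (λ j → separatedBy? F j i) (below i)

-- Number of classes induced by F: each class is counted via its least element.
numClasses : {n : ℕ} → List (Subset n) → ℕ
numClasses {n} F = length (filter (isClassRep? F) (allFin n))

module Submission where

-- Greedily add, from a test cover 𝒮 (all of 𝒯, or the singletons), a test separating two items
-- that F does not yet separate.  Such a test splits a class, so the number of classes grows by
-- at least one per added test; as there are at most n classes, at most n − numClasses F tests
-- are added, giving |F′| ≤ |F| + n − numClasses F ≤ n − k.

open import Defs
open import Data.Nat as ℕ using (ℕ; suc; zero; s≤s; z≤n)
import Data.Nat.Properties as ℕ
open import Data.Integer using (ℤ; +_; _+_; _-_; -_; _≤_)
open import Data.Integer.Base using (+≤+)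
open import Data.Integer.Properties using (+-monoˡ-≤; +-monoʳ-≤; module ≤-Reasoning)
open import Data.Integer.Tactic.RingSolver using (solve-∀)
open import Data.Fin as Fin using (Fin; _<?_)
open import Data.Fin.Induction using (Acc; acc; <-wellFounded)
open import Data.Fin.Properties using (<-cmp; <⇒≢)
open import Data.Fin.Subset using (Subset; ⁅_⁆)
open import Data.Fin.Subset.Properties using (_∈?_; x∈⁅x⁆; x∈⁅y⁆⇒x≡y)
open import Data.List using (List; []; _∷_; length; filter; allFin; map)
open import Data.List.Properties using (length-filter; length-tabulate)
open import Data.List.Membership.Propositional using (_∈_; _∉_; find; lose)
open import Data.List.Membership.Propositional.Properties
  using (∈-filter⁻; ∈-filter⁺; ∈-allFin; ∈-map⁺; ∈-map⁻)
open import Data.List.Relation.Binary.Subset.Propositional using (_⊆_)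
open import Data.List.Relation.Unary.All using (all?)
import Data.List.Relation.Unary.All as All
open import Data.List.Relation.Unary.All.Properties using (¬All⇒Any¬; ¬Any⇒All¬)
open import Data.List.Relation.Unary.AllPairs using (_∷_)
open import Data.List.Relation.Unary.Any using (here; there)
import Data.List.Relation.Unary.Any as Any
open import Data.List.Relation.Unary.Unique.Propositional using (Unique)
open import Data.Empty using (⊥-elim)
open import Data.Product as Product using (_×_; _,_; ∃₂; ∃-syntax)
open import Data.Sum as Sum using (_⊎_; inj₁; inj₂; [_,_]′)
open import Function using (_∘_; id)
open import Relation.Nullary using (¬_; yes; no; contradiction)
open import Relation.Binary using (Tri; tri<; tri≈; tri>)
open import Relation.Binary.PropositionalEquality using (_≡_; refl)
open import Relation.Unary using (Pred; Decidable)

module _ {a p q} {A : Set a} {P : Pred A p} {Q : Pred A q}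
         (P? : Decidable P) (Q? : Decidable Q) (P⇒Q : ∀ {x} → P x → Q x) where

  length-filter-mono : ∀ xs → length (filter P? xs) ℕ.≤ length (filter Q? xs)
  length-filter-mono [] = z≤n
  length-filter-mono (x ∷ xs) with P? x | Q? x
  ... | yes _  | yes _  = s≤s (length-filter-mono xs)
  ... | yes px | no ¬qx = contradiction (P⇒Q px) ¬qx
  ... | no _   | yes _  = ℕ.m≤n⇒m≤1+n (length-filter-mono xs)
  ... | no _   | no _   = length-filter-mono xs

  length-filter-strictMono : ∀ xs {x} → x ∈ xs → ¬ P x → Q x →
                             length (filter P? xs) ℕ.< length (filter Q? xs)
  length-filter-strictMono (y ∷ xs) (here refl) ¬py qy with P? y | Q? y
  ... | yes py | _      = contradiction py ¬py
  ... | no _   | yes _  = s≤s (length-filter-mono xs)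
  ... | no _   | no ¬qy = contradiction qy ¬qy
  length-filter-strictMono (y ∷ xs) (there x∈xs) ¬px qx with P? y | Q? y
  ... | yes _  | yes _  = s≤s (length-filter-strictMono xs x∈xs ¬px qx)
  ... | yes py | no ¬qy = contradiction (P⇒Q py) ¬qy
  ... | no _   | yes _  = ℕ.m≤n⇒m≤1+n (length-filter-strictMono xs x∈xs ¬px qx)
  ... | no _   | no _   = length-filter-strictMono xs x∈xs ¬px qx

≤-minus : ∀ {a b c n k : ℤ} → a + c ≤ b + n → b + k ≤ c → a ≤ n - k
≤-minus {a} {b} {c} {n} {k} a+c≤b+n b+k≤c = begin
  a                      ≡⟨ add-sub a (b + k) ⟩
  a + (b + k) - (b + k)  ≤⟨ +-monoˡ-≤ (- (b + k)) (+-monoʳ-≤ a b+k≤c) ⟩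
  a + c - (b + k)        ≤⟨ +-monoˡ-≤ (- (b + k)) a+c≤b+n ⟩
  b + n - (b + k)        ≡⟨ sub-cancelˡ b n k ⟩
  n - k                  ∎
  where
  open ≤-Reasoning
  add-sub : ∀ x y → x ≡ x + y - y
  add-sub = solve-∀
  sub-cancelˡ : ∀ x y z → x + y - (x + z) ≡ y - z
  sub-cancelˡ = solve-∀

module _ {n : ℕ} where

  Separates-sym : ∀ {T : Subset n} {i j} → Separates T i j → Separates T j i
  Separates-sym = Sum.swap ∘ Sum.map Product.swap Product.swap

  Separates-irrefl : ∀ {T : Subset n} {i} → ¬ Separates T i i
  Separates-irrefl (inj₁ (i∈T , i∉T)) = i∉T i∈T
  Separates-irrefl (inj₂ (i∉T , i∈T)) = i∉T i∈T

  Separates-cotrans : ∀ {T : Subset n} {i k} → Separates T i k →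
                      ∀ j → Separates T i j ⊎ Separates T j k
  Separates-cotrans {T} s j with j ∈? T
  Separates-cotrans (inj₁ (i∈T , k∉T)) j | yes j∈T = inj₂ (inj₁ (j∈T , k∉T))
  Separates-cotrans (inj₂ (i∉T , k∈T)) j | yes j∈T = inj₁ (inj₂ (i∉T , j∈T))
  Separates-cotrans (inj₁ (i∈T , k∉T)) j | no j∉T  = inj₁ (inj₁ (i∈T , j∉T))
  Separates-cotrans (inj₂ (i∉T , k∈T)) j | no j∉T  = inj₂ (inj₂ (j∉T , k∈T))

  SeparatedBy-sym : ∀ {G : List (Subset n)} {i j} → SeparatedBy G i j → SeparatedBy G j i
  SeparatedBy-sym = Any.map Separates-sym

  SeparatedBy-cotrans : ∀ {G : List (Subset n)} {i k} → SeparatedBy G i k →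
                        ∀ j → SeparatedBy G i j ⊎ SeparatedBy G j k
  SeparatedBy-cotrans (here s)  j = Sum.map here here (Separates-cotrans s j)
  SeparatedBy-cotrans (there s) j = Sum.map there there (SeparatedBy-cotrans s j)

  <⇒∈-below : ∀ {i j : Fin n} → i Fin.< j → i ∈ below j
  <⇒∈-below {i} {j} = ∈-filter⁺ (_<? j) (∈-allFin i)

  ∈-below⇒< : ∀ {i j : Fin n} → i ∈ below j → i Fin.< j
  ∈-below⇒< {j = j} i∈below = Product.proj₂ (∈-filter⁻ (_<? j) {xs = allFin n} i∈below)

  unseparatedBelow⇒¬IsClassRep : ∀ {G : List (Subset n)} {i j} → i Fin.< j →
                                 ¬ SeparatedBy G i j → ¬ IsClassRep G j
  unseparatedBelow⇒¬IsClassRep i<j unsep rep = unsep (All.lookup rep (<⇒∈-below i<j))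

  ¬IsClassRep⇒unseparatedBelow : ∀ {G : List (Subset n)} {j} → ¬ IsClassRep G j →
                                 ∃[ i ] (i Fin.< j × ¬ SeparatedBy G i j)
  ¬IsClassRep⇒unseparatedBelow {G} {j} ¬rep
    with i , i∈below , unsep ← find (¬All⇒Any¬ (λ i → separatedBy? G i j) (below j) ¬rep)
    = i , ∈-below⇒< i∈below , unsep

  IsClassRep-∷ : ∀ {G : List (Subset n)} {T j} → IsClassRep G j → IsClassRep (T ∷ G) j
  IsClassRep-∷ = All.map there

  -- If T splits the G-class of i < j, the part of that class not containing its least element
  -- has a least element m, which becomes a new representative; we reach m by descending from j.
  newClassRep : ∀ (G : List (Subset n)) (T : Subset n) {i j} → Acc Fin._<_ j → i Fin.< j →
                ¬ SeparatedBy G i j → Separates T i j →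
                ∃[ m ] (¬ IsClassRep G m × IsClassRep (T ∷ G) m)
  newClassRep G T {i} {j} (acc rs) i<j unsep sep with isClassRep? (T ∷ G) j
  ... | yes rep = j , unseparatedBelow⇒¬IsClassRep i<j unsep , rep
  ... | no ¬rep with y , y<j , unsep-yj ← ¬IsClassRep⇒unseparatedBelow ¬rep = recurse (<-cmp y i)
    where
    unsep-yi : ¬ SeparatedBy G y i
    unsep-yi s = [ unsep-yj ∘ there , unsep ∘ SeparatedBy-sym ]′ (SeparatedBy-cotrans s j)
    sep-iy : Separates T i y
    sep-iy = [ id , (λ s → contradiction (here s) unsep-yj) ]′ (Separates-cotrans sep y)
    recurse : Tri (y Fin.< i) (y ≡ i) (i Fin.< y) → ∃[ m ] (¬ IsClassRep G m × IsClassRep (T ∷ G) m)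
    recurse (tri< y<i _ _)  = newClassRep G T (rs i<j) y<i unsep-yi (Separates-sym sep-iy)
    recurse (tri≈ _ refl _) = contradiction sep-iy Separates-irrefl
    recurse (tri> _ _ i<y)  = newClassRep G T (rs y<j) i<y (unsep-yi ∘ SeparatedBy-sym) sep-iy

  numClasses≤n : ∀ (G : List (Subset n)) → numClasses G ℕ.≤ n
  numClasses≤n G =
    ℕ.≤-trans (length-filter (isClassRep? G) (allFin n)) (ℕ.≤-reflexive (length-tabulate id))

  numClasses-∷-< : ∀ {G : List (Subset n)} {T i j} → i Fin.< j →
                   ¬ SeparatedBy G i j → Separates T i j → numClasses G ℕ.< numClasses (T ∷ G)
  numClasses-∷-< {G} {T} {j = j} i<j unsep sep
    with m , ¬rep , rep ← newClassRep G T (<-wellFounded j) i<j unsep sep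
    = length-filter-strictMono (isClassRep? G) (isClassRep? (T ∷ G)) IsClassRep-∷
                               (allFin n) (∈-allFin m) ¬rep rep

  testCover-or-unseparated : ∀ (G : List (Subset n)) →
                             IsTestCover G ⊎ ∃₂ λ i j → i Fin.< j × ¬ SeparatedBy G i j
  testCover-or-unseparated G with all? (isClassRep? G) (allFin n)
  ... | yes allReps = inj₁ cover
    where
    separatedBelow : ∀ {i j} → i Fin.< j → SeparatedBy G i j
    separatedBelow {j = j} i<j = All.lookup (All.lookup allReps (∈-allFin j)) (<⇒∈-below i<j)
    cover : IsTestCover G
    cover i j i≢j with <-cmp i j
    ... | tri< i<j _ _ = separatedBelow i<j
    ... | tri≈ _ i≡j _ = contradiction i≡j i≢j
    ... | tri> _ _ j<i = SeparatedBy-sym (separatedBelow j<i)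
  ... | no ¬allReps with j , _ , ¬rep ← find (¬All⇒Any¬ (isClassRep? G) (allFin n) ¬allReps)
    with i , i<j , unsep ← ¬IsClassRep⇒unseparatedBelow ¬rep
    = inj₂ (i , j , i<j , unsep)

module Completion {n : ℕ} (𝒮 : List (Subset n)) (𝒮-cover : IsTestCover 𝒮) where

  Completion : List (Subset n) → Set
  Completion G = ∃[ G′ ] (Unique G′ × G ⊆ G′ × (∀ {T} → T ∈ G′ → T ∈ G ⊎ T ∈ 𝒮) ×
                          IsTestCover G′ × length G′ ℕ.+ numClasses G ℕ.≤ length G ℕ.+ n)

  completion-∷ : ∀ {G T} → T ∈ 𝒮 → numClasses G ℕ.< numClasses (T ∷ G) →
                 Completion (T ∷ G) → Completion G
  completion-∷ {G} {T} T∈𝒮 growth (G′ , unique , TG⊆G′ , origin , cover , size) =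
    G′ , unique , TG⊆G′ ∘ there , origin′ ∘ origin , cover ,
    ℕ.≤-pred (ℕ.≤-trans (ℕ.+-monoʳ-< (length G′) growth) size)
    where
    origin′ : ∀ {U} → U ∈ T ∷ G ⊎ U ∈ 𝒮 → U ∈ G ⊎ U ∈ 𝒮
    origin′ (inj₁ (here refl)) = inj₂ T∈𝒮
    origin′ (inj₁ (there U∈G)) = inj₁ U∈G
    origin′ (inj₂ U∈𝒮)        = inj₂ U∈𝒮

  -- Each added test creates a new class, so f bounds the number of tests still to be added.
  complete-within : ∀ f (G : List (Subset n)) → Unique G → n ℕ.≤ f ℕ.+ numClasses G →
                    Completion G
  complete-within f G unique fuel with testCover-or-unseparated G
  ... | inj₁ cover = G , unique , id , inj₁ , cover , ℕ.+-monoʳ-≤ (length G) (numClasses≤n G)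
  ... | inj₂ (i , j , i<j , unsep)
    with T , T∈𝒮 , sep ← find (𝒮-cover i j (<⇒≢ i<j)) = extend f fuel
    where
    growth : numClasses G ℕ.< numClasses (T ∷ G)
    growth = numClasses-∷-< i<j unsep sep
    T∉G : T ∉ G
    T∉G T∈G = unsep (lose T∈G sep)
    extend : ∀ f → n ℕ.≤ f ℕ.+ numClasses G → Completion G
    extend zero    fuel =
      ⊥-elim (ℕ.<-irrefl refl (ℕ.≤-<-trans fuel (ℕ.<-≤-trans growth (numClasses≤n (T ∷ G)))))
    extend (suc f) fuel = completion-∷ T∈𝒮 growth
      (complete-within f (T ∷ G) (¬Any⇒All¬ G T∉G ∷ unique)
                       (ℕ.≤-trans fuel (ℕ.+-monoʳ-< f growth)))

  complete : ∀ (G : List (Subset n)) → Unique G → Completion G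
  complete G unique = complete-within n G unique (ℕ.m≤m+n n (numClasses G))

singletons-testCover : ∀ {n} → IsTestCover (map ⁅_⁆ (allFin n))
singletons-testCover i j i≢j =
  lose (∈-map⁺ ⁅_⁆ (∈-allFin j)) (inj₂ ((λ i∈⁅j⁆ → i≢j (x∈⁅y⁆⇒x≡y j i∈⁅j⁆)) , x∈⁅x⁆ j))

lemma1 : (n : ℕ) (𝒯 : List (Subset n)) → Unique 𝒯 → IsTestCover 𝒯 →
         (k : ℤ) (F : List (Subset n)) → Unique F → F ⊆ 𝒯 →
         + length F + k ≤ + numClasses F →
         (∃[ F′ ] (Unique F′ × F ⊆ F′ × F′ ⊆ 𝒯 × IsTestCover F′ ×
                   + length F′ ≤ + n - k))
         × (((i : Fin n) → ⁅ i ⁆ ∈ 𝒯) →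
            ∃[ F′ ] (Unique F′ × F ⊆ F′ × F′ ⊆ 𝒯 × IsTestCover F′ ×
                     + length F′ ≤ + n - k ×
                     ((T : Subset n) → T ∈ F′ → T ∉ F → ∃[ i ] T ≡ ⁅ i ⁆)))
lemma1 n 𝒯 _ 𝒯-cover k F F-unique F⊆𝒯 many-classes = fromAllTests , fromSingletons
  where
  size : ∀ (F′ : List (Subset n)) → length F′ ℕ.+ numClasses F ℕ.≤ length F ℕ.+ n →
         + length F′ ≤ + n - k
  size F′ bound =
    ≤-minus {+ length F′} {+ length F} {+ numClasses F} {+ n} {k} (+≤+ bound) many-classes

  fromAllTests : ∃[ F′ ] (Unique F′ × F ⊆ F′ × F′ ⊆ 𝒯 × IsTestCover F′ × + length F′ ≤ + n - k)
  fromAllTests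
    with F′ , unique , F⊆F′ , origin , cover , bound ← Completion.complete 𝒯 𝒯-cover F F-unique
    = F′ , unique , F⊆F′ , [ F⊆𝒯 , id ]′ ∘ origin , cover , size F′ bound

  fromSingletons : ((i : Fin n) → ⁅ i ⁆ ∈ 𝒯) →
                   ∃[ F′ ] (Unique F′ × F ⊆ F′ × F′ ⊆ 𝒯 × IsTestCover F′ × + length F′ ≤ + n - k ×
                            ((T : Subset n) → T ∈ F′ → T ∉ F → ∃[ i ] T ≡ ⁅ i ⁆))
  fromSingletons singletons∈𝒯
    with F′ , unique , F⊆F′ , origin , cover , bound
           ← Completion.complete (map ⁅_⁆ (allFin n)) singletons-testCover F F-unique
    = F′ , unique , F⊆F′ , [ F⊆𝒯 , singleton∈𝒯 ]′ ∘ origin , cover , size F′ bound , added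
    where
    singleton∈𝒯 : map ⁅_⁆ (allFin n) ⊆ 𝒯
    singleton∈𝒯 T∈singletons with i , _ , refl ← ∈-map⁻ ⁅_⁆ T∈singletons = singletons∈𝒯 i
    added : (T : Subset n) → T ∈ F′ → T ∉ F → ∃[ i ] T ≡ ⁅ i ⁆
    added T T∈F′ T∉F with origin T∈F′
    ... | inj₁ T∈F = contradiction T∈F T∉F
    ... | inj₂ T∈singletons with i , _ , T≡⁅i⁆ ← ∈-map⁻ ⁅_⁆ T∈singletons = i , T≡⁅i⁆
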